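{- (Distant Vertex Lemma) For $j\in\{1,2\}$ let $G_j$ be an interval graph with a clean clique separation $(A_j,C_j,B_j)$ such that $|B_j|\ge 2$, and let $b_j\in B_j$ be a vertex such that $G_j-b_j$ is connected and $N_{G_j}(b_j)\cap C_j$ is as small as possible under this condition. If $\{\!\!\{\deg_{G_1}(u): u\in N_{G_1}(b_1)\}\!\!\}=\{\!\!\{\deg_{G_2}(u): u\in N_{G_2}(b_2)\}\!\!\}$ and there is an isomorphism $\varphi$ from $G_1-b_1$ to $G_2-b_2$ with $\varphi(A_1)=A_2$ and $\varphi(C_1)=C_2$, then $H_{A_1}\cong H_{A_2}$ as annotated graphs (where $H_{A_j}$ is taken with respect to $G_j$ and $(A_j,C_j,B_j)$).
   Context: A clean clique separation of a graph $G$ is an ordered partition $(A,C,B)$ of $V(G)$ with no edges between $A$ and $B$ such that for some interval representation $\{[\ell_v,r_v]\}$ of $G$ (distinct vertices adjacent iff intervals intersect), $\emptyset\neq\bigcap_{c\in C}[\ell_c,r_c]\subseteq(\max_{a\in A}r_a,\min_{b\in B}\ell_b)$. An annotated graph is a pair $(H,\lambda)$ with $\lambda:V(H)\to\mathbb{N}\cup\{\bot\}$; annotated isomorphisms are graph isomorphisms preserving $\lambda$. For such a separation, $H_A$ is the annotated graph $(G[A\cup C],\lambda)$ with $\lambda(h)=\bot$ for $h\in A$ and $\lambda(h)=\deg_G(h)$ for $h\in C$.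
   Formalization: The interval representations underlying both the interval graphs $G_j$ and the clean clique separations have rational endpoints. -}

module Defs where

open import Data.Nat using (ℕ; _≤_)
open import Data.Bool using (Bool; true; false; T; not; _∧_; _∨_)
open import Data.Fin using (Fin; _≟_)
open import Data.List using (List; length; filterᵇ; map)
open import Data.List.Base using (allFin)
open import Data.Maybe using (Maybe; just; nothing)
open import Data.Product using (Σ; ∃; _×_; _,_)
open import Data.Rational using (ℚ) renaming (_≤_ to _≤ℚ_; _<_ to _<ℚ_)
open import Relation.Binary.PropositionalEquality using (_≡_; _≢_)
open import Relation.Nullary.Decidable using (⌊_⌋)
open import Function using (_⇔_)

record Graph : Set where
  field
    n      : ℕ
    adj    : Fin n → Fin n → Bool
    sym    : ∀ u v → adj u v ≡ adj v u
    irrefl : ∀ v → adj v v ≡ false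
open Graph public

VSet : Graph → Set
VSet G = Fin (n G) → Bool

nbrs : (G : Graph) → Fin (n G) → List (Fin (n G))
nbrs G v = filterᵇ (adj G v) (allFin (n G))

deg : (G : Graph) → Fin (n G) → ℕ
deg G v = length (nbrs G v)

size : (G : Graph) → VSet G → ℕ
size G S = length (filterᵇ S (allFin (n G)))

minusV : (G : Graph) → Fin (n G) → VSet G
minusV G b v = not ⌊ v ≟ b ⌋

data Walk (G : Graph) (S : VSet G) : Fin (n G) → Fin (n G) → Set where
  here : ∀ {v} → T (S v) → Walk G S v v
  step : ∀ {u w v} → T (S u) → T (adj G u w) → Walk G S w v → Walk G S u v

Connected : (G : Graph) → VSet G → Set
Connected G S = ∀ u v → T (S u) → T (S v) → Walk G S u v

record IntervalRep (G : Graph) : Set where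
  field
    ℓ  : Fin (n G) → ℚ
    r  : Fin (n G) → ℚ
    ℓ≤r : ∀ v → ℓ v ≤ℚ r v
    adj⇔ : ∀ u v → u ≢ v → (T (adj G u v) ⇔ ((ℓ u ≤ℚ r v) × (ℓ v ≤ℚ r u)))
open IntervalRep public

IsIntervalGraph : Graph → Set
IsIntervalGraph G = IntervalRep G

-- Ordered partition (A , C , B) given by a labelling of the vertices
data Side : Set where
  sA sC sB : Side

isA isC isB : Side → Bool
isA sA = true
isA _  = false
isC sC = true
isC _  = false
isB sB = true
isB _  = false

InAllC : (G : Graph) → (Fin (n G) → Side) → IntervalRep G → ℚ → Set
InAllC G p R x = ∀ c → p c ≡ sC → (ℓ R c ≤ℚ x) × (x ≤ℚ r R c)

-- Clean clique separation (A,C,B): no A-B edges, and for some interval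
-- representation, ∅ ≠ ⋂_{c∈C} I_c ⊆ (max_{a∈A} r_a , min_{b∈B} ℓ_b)
-- (max over ∅ = -∞, min over ∅ = +∞, ⋂ over ∅ = whole line).
CleanCliqueSep : (G : Graph) → (Fin (n G) → Side) → Set
CleanCliqueSep G p =
  (∀ a b → p a ≡ sA → p b ≡ sB → adj G a b ≡ false) ×
  Σ (IntervalRep G) λ R →
    (∃ λ x → InAllC G p R x) ×
    (∀ x → InAllC G p R x →
       (∀ a → p a ≡ sA → r R a <ℚ x) × (∀ b → p b ≡ sB → x <ℚ ℓ R b))

DistantChoice : (G : Graph) → (Fin (n G) → Side) → Fin (n G) → Set
DistantChoice G p b =
  (p b ≡ sB) × Connected G (minusV G b) ×
  (∀ b' → p b' ≡ sB → Connected G (minusV G b') →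
     size G (λ v → adj G b v ∧ isC (p v)) ≤ size G (λ v → adj G b' v ∧ isC (p v)))

record SubIso (G₁ : Graph) (S₁ : VSet G₁) (G₂ : Graph) (S₂ : VSet G₂) : Set where
  field
    to       : Fin (n G₁) → Fin (n G₂)
    from     : Fin (n G₂) → Fin (n G₁)
    to-mem   : ∀ v → T (S₁ v) → T (S₂ (to v))
    from-mem : ∀ v → T (S₂ v) → T (S₁ (from v))
    from-to  : ∀ v → T (S₁ v) → from (to v) ≡ v
    to-from  : ∀ v → T (S₂ v) → to (from v) ≡ v
    adj-pres : ∀ u v → T (S₁ u) → T (S₁ v) → adj G₂ (to u) (to v) ≡ adj G₁ u v
open SubIso public

-- Annotated graphs: induced subgraph G[S] with labelling λ : V → ℕ ∪ {⊥}
-- (⊥ = nothing); an annotated isomorphism preserves the labels.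
AnnIso : (G₁ : Graph) (S₁ : VSet G₁) (λ₁ : Fin (n G₁) → Maybe ℕ)
         (G₂ : Graph) (S₂ : VSet G₂) (λ₂ : Fin (n G₂) → Maybe ℕ) → Set
AnnIso G₁ S₁ λ₁ G₂ S₂ λ₂ =
  Σ (SubIso G₁ S₁ G₂ S₂) λ φ → ∀ v → T (S₁ v) → λ₂ (to φ v) ≡ λ₁ v

HA-vertices : (G : Graph) → (Fin (n G) → Side) → VSet G
HA-vertices G p v = isA (p v) ∨ isC (p v)

HA-label : (G : Graph) → (Fin (n G) → Side) → Fin (n G) → Maybe ℕ
HA-label G p v with p v
... | sA = nothing
... | sC = just (deg G v)
... | sB = nothing

{-# OPTIONS --safe #-}
module Submission where

-- Write deg⁻ for degrees in G − b.  Every C-neighbour of the distant vertex b is adjacent to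
-- all of B: otherwise the vertex with rightmost left endpoint would lie in B, be removable
-- (it is simplicial) and see strictly fewer vertices of C than b.  Hence a C-neighbour of b
-- has degree at least |B ∪ C| − 1, whereas a vertex of B has degree at most |B ∪ C| − 2, so
-- the degree multiset of N(b) counts, for every e, the C-neighbours of b with deg⁻ = e; and φ
-- transports these counts from G₁ − b₁ to G₂ − b₂.  Since the A-neighbourhoods of C-vertices
-- are nested, two C-vertices that see B − b and have the same deg⁻ are twins in G − b.
-- So if φ sends a C-neighbour x of b₁ to a non-neighbour of b₂, counting yields a C-vertex y
-- with the same deg⁻ and the opposite behaviour, and composing φ with the transposition (x y)
-- lowers the number of such mismatches.  Once there are none, φ preserves the degrees of the
-- C-vertices and restricts to an annotated isomorphism H_{A₁} ≅ H_{A₂}.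

open import Defs renaming (sym to adj-sym)
open import Data.Bool using (Bool; true; false; T; not; _∧_; _∨_; if_then_else_)
open import Data.Empty using (⊥-elim)
open import Data.Fin using (Fin; _≟_)
open import Data.Fin.Patterns using (0F)
open import Data.Fin.Permutation.Components using (transpose; transpose-inverse)
open import Data.Fin.Properties using (any?)
open import Data.List using (List; []; _∷_; length; filter; filterᵇ; map; allFin)
open import Data.List.Properties using (filter-notAll; filter-none; length-map)
open import Data.List.Membership.Propositional using (_∈_)
open import Data.List.Membership.Propositional.Properties using (∈-filter⁺; ∈-filter⁻; ∈-allFin; ∈-map⁺)
open import Data.List.Relation.Binary.Permutation.Propositional using (_↭_)
open import Data.List.Relation.Binary.Permutation.Propositional.Properties using (↭-length; filter-↭)
open import Data.List.Relation.Binary.Subset.Propositional using (_⊆_)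
open import Data.List.Relation.Unary.All using (lookup)
open import Data.List.Relation.Unary.All.Properties using (all-filter; tabulate⁺)
open import Data.List.Relation.Unary.AllPairs using (_∷_)
open import Data.List.Relation.Unary.Any using (Any; here; there)
import Data.List.Relation.Unary.Any as Any
open import Data.List.Relation.Unary.Unique.Propositional using (Unique)
import Data.List.Relation.Unary.Unique.Propositional.Properties as Unique
open import Data.Maybe using (just)
open import Data.Nat using (ℕ; zero; suc; _+_; _≤_; _<_; _≡ᵇ_; z≤n; s≤s)
open import Data.Nat.Properties
  using (≤-refl; ≤-trans; <-≤-trans; ≤-antisym; ≤-reflexive; ≤-pred; <-irrefl; n≮0; +-suc; suc-injective;
         ≡ᵇ⇒≡; ≡⇒≡ᵇ; module ≤-Reasoning)
open import Data.Product using (Σ; ∃; _×_; _,_; proj₁; proj₂)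
open import Data.Rational using (ℚ) renaming (_≤_ to _≤ℚ_; _<_ to _<ℚ_)
import Data.Rational.Properties as ℚ
open import Data.Sum using (_⊎_; inj₁; inj₂)
open import Data.Unit using (tt)
open import Function using (Equivalence)
open import Relation.Binary.Bundles using (DecTotalOrder)
open import Relation.Binary.Definitions using (DecidableEquality)
open import Relation.Binary.PropositionalEquality
  using (_≡_; _≢_; refl; sym; trans; cong; cong₂; subst; subst₂; module ≡-Reasoning)
open import Relation.Nullary using (¬_; Dec; yes; no)
open import Relation.Nullary.Decidable
  using (⌊_⌋; ¬?; T?; toWitness; fromWitness; toWitnessFalse; fromWitnessFalse; decidable-stable)
open import Data.List.Extrema (DecTotalOrder.totalOrder ℚ.≤-decTotalOrder)
  using (argmax; argmin; f[xs]≤f[argmax]; f[argmin]≤f[xs]; argmin-all)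

private variable
  m k : ℕ

T-∧⁺ : ∀ {x y} → T x → T y → T (x ∧ y)
T-∧⁺ {true} _ t = t

T-∧ˡ : ∀ {x y} → T (x ∧ y) → T x
T-∧ˡ {true} _ = tt

T-∧ʳ : ∀ {x y} → T (x ∧ y) → T y
T-∧ʳ {true} t = t

T-not⁺ : ∀ {x} → ¬ T x → T (not x)
T-not⁺ {true}  ¬t = ¬t tt
T-not⁺ {false} _  = tt

T-not⁻ : ∀ {x} → T (not x) → ¬ T x
T-not⁻ {true} () _

T⇒≡true : ∀ {x} → T x → x ≡ true
T⇒≡true {true} _ = refl

T-ext : ∀ {x y} → (T x → T y) → (T y → T x) → x ≡ y
T-ext {false} {false} _ _   = refl
T-ext {false} {true}  _ y⇒x = ⊥-elim (y⇒x tt)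
T-ext {true}  {false} x⇒y _ = ⊥-elim (x⇒y tt)
T-ext {true}  {true}  _ _   = refl

unique-⊆⇒length-≤ : ∀ {A : Set} → DecidableEquality A → {xs ys : List A} →
                    Unique xs → xs ⊆ ys → length xs ≤ length ys
unique-⊆⇒length-≤ _≟ₐ_ {[]}     _              _     = z≤n
unique-⊆⇒length-≤ _≟ₐ_ {x ∷ xs} {ys} (x∉xs ∷ xs!) xs⊆ys =
  ≤-trans (s≤s (unique-⊆⇒length-≤ _≟ₐ_ xs! xs⊆ys∖x)) (filter-notAll ≢x? ys x∈ys)
  where
  ≢x? : ∀ y → Dec (y ≢ x)
  ≢x? y = ¬? (y ≟ₐ x)
  xs⊆ys∖x : xs ⊆ filter ≢x? ys
  xs⊆ys∖x z∈xs = ∈-filter⁺ ≢x? (xs⊆ys (there z∈xs)) (λ z≡x → lookup x∉xs z∈xs (sym z≡x))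
  x∈ys : Any (λ y → ¬ y ≢ x) ys
  x∈ys = Any.map (λ { refl y≢y → y≢y refl }) (xs⊆ys (here refl))

length-filterᵇ-map : {A B : Set} (P : A → Bool) (f : A → B) (Q : B → Bool) (xs : List A) →
  length (filterᵇ Q (map f (filterᵇ P xs))) ≡ length (filterᵇ (λ u → P u ∧ Q (f u)) xs)
length-filterᵇ-map P f Q [] = refl
length-filterᵇ-map P f Q (x ∷ xs) with P x
... | false = length-filterᵇ-map P f Q xs
... | true with Q (f x)
...   | true  = cong suc (length-filterᵇ-map P f Q xs)
...   | false = length-filterᵇ-map P f Q xs

count : (Fin m → Bool) → ℕ
count {m} P = length (filterᵇ P (allFin m))

-- Opaque, so that unification never unfolds P ∖ w and the implicit arguments of its
-- introduction and elimination rules stay inferable.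
opaque
  _∖_ : (Fin m → Bool) → Fin m → Fin m → Bool
  (P ∖ w) u = not ⌊ u ≟ w ⌋ ∧ P u

  ∖⁺ : {P : Fin m → Bool} {w v : Fin m} → v ≢ w → T (P v) → T ((P ∖ w) v)
  ∖⁺ {w = w} {v} v≢w Pv = T-∧⁺ {not ⌊ v ≟ w ⌋} (fromWitnessFalse v≢w) Pv

  ∖⁻ˡ : {P : Fin m → Bool} {w v : Fin m} → T ((P ∖ w) v) → v ≢ w
  ∖⁻ˡ {w = w} {v} t = toWitnessFalse (T-∧ˡ {not ⌊ v ≟ w ⌋} t)

  ∖⁻ʳ : {P : Fin m → Bool} {w v : Fin m} → T ((P ∖ w) v) → T (P v)
  ∖⁻ʳ {w = w} {v} t = T-∧ʳ {not ⌊ v ≟ w ⌋} t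

  ∖-≢ : (P : Fin m → Bool) {w v : Fin m} → v ≢ w → (P ∖ w) v ≡ P v
  ∖-≢ P {w} {v} v≢w with v ≟ w
  ... | yes v≡w = ⊥-elim (v≢w v≡w)
  ... | no _    = refl

  length-filterᵇ-split : (P : Fin m → Bool) (w : Fin m) (xs : List (Fin m)) →
    length (filterᵇ P xs) ≡ length (filterᵇ (λ u → ⌊ u ≟ w ⌋ ∧ P u) xs) + length (filterᵇ (P ∖ w) xs)
  length-filterᵇ-split P w [] = refl
  length-filterᵇ-split P w (x ∷ xs) with P x | x ≟ w
  ... | true  | yes _ = cong suc (length-filterᵇ-split P w xs)
  ... | true  | no _  = trans (cong suc (length-filterᵇ-split P w xs)) (sym (+-suc _ _))
  ... | false | yes _ = length-filterᵇ-split P w xs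
  ... | false | no _  = length-filterᵇ-split P w xs

∈-filterᵇ-allFin⁺ : (P : Fin m → Bool) {v : Fin m} → T (P v) → v ∈ filterᵇ P (allFin m)
∈-filterᵇ-allFin⁺ P {v} = ∈-filter⁺ (λ u → T? (P u)) (∈-allFin v)

∈-filterᵇ-allFin⁻ : (P : Fin m → Bool) {v : Fin m} → v ∈ filterᵇ P (allFin m) → T (P v)
∈-filterᵇ-allFin⁻ {m} P v∈ = proj₂ (∈-filter⁻ (λ u → T? (P u)) {xs = allFin m} v∈)

count-≤ : {P : Fin m → Bool} {Q : Fin k → Bool} (f : Fin m → Fin k) (g : Fin k → Fin m) →
          (∀ v → T (P v) → T (Q (f v))) → (∀ v → T (P v) → g (f v) ≡ v) → count P ≤ count Q
count-≤ {m} {k} {P} {Q} f g P⇒Qf g∘f =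
  ≤-trans (unique-⊆⇒length-≤ _≟_ P-unique P⊆gQ) (≤-reflexive (length-map g (filterᵇ Q (allFin k))))
  where
  P-unique : Unique (filterᵇ P (allFin m))
  P-unique = Unique.filter⁺ (λ u → T? (P u)) (Unique.allFin⁺ m)
  P⊆gQ : filterᵇ P (allFin m) ⊆ map g (filterᵇ Q (allFin k))
  P⊆gQ {v} v∈P = subst (_∈ map g _) (g∘f v Pv) (∈-map⁺ g (∈-filterᵇ-allFin⁺ Q (P⇒Qf v Pv)))
    where Pv = ∈-filterᵇ-allFin⁻ P v∈P

count-mono : {P Q : Fin m → Bool} → (∀ v → T (P v) → T (Q v)) → count P ≤ count Q
count-mono P⇒Q = count-≤ (λ v → v) (λ v → v) P⇒Q (λ _ _ → refl)

count-≡ : {P : Fin m → Bool} {Q : Fin k → Bool} (f : Fin m → Fin k) (g : Fin k → Fin m) →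
          (∀ v → T (P v) → T (Q (f v))) → (∀ v → T (P v) → g (f v) ≡ v) →
          (∀ w → T (Q w) → T (P (g w))) → (∀ w → T (Q w) → f (g w) ≡ w) → count P ≡ count Q
count-≡ f g P⇒Qf g∘f Q⇒Pg f∘g = ≤-antisym (count-≤ f g P⇒Qf g∘f) (count-≤ g f Q⇒Pg f∘g)

count-cong : {P Q : Fin m → Bool} → (∀ v → T (P v) → T (Q v)) → (∀ v → T (Q v) → T (P v)) →
             count P ≡ count Q
count-cong P⇒Q Q⇒P = ≤-antisym (count-mono P⇒Q) (count-mono Q⇒P)

count-none : {P : Fin m → Bool} → (∀ v → ¬ T (P v)) → count P ≡ 0
count-none {P = P} none = cong length (filter-none (λ u → T? (P u)) (tabulate⁺ none))

count-singleton : (P : Fin m → Bool) (w : Fin m) → count (λ u → ⌊ u ≟ w ⌋ ∧ P u) ≡ (if P w then 1 else 0)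
count-singleton P w with P w in Pw
... | true  = count-≡ {Q = λ (_ : Fin 1) → true} (λ _ → 0F) (λ _ → w)
                (λ _ _ → tt) (λ u t → sym (toWitness (T-∧ˡ {⌊ u ≟ w ⌋} t)))
                (λ _ _ → T-∧⁺ (fromWitness refl) (subst T (sym Pw) tt)) (λ { 0F _ → refl })
... | false = count-none λ u t →
                subst T Pw (subst (λ v → T (P v)) (toWitness (T-∧ˡ {⌊ u ≟ w ⌋} t)) (T-∧ʳ {⌊ u ≟ w ⌋} t))

count-split : (P : Fin m → Bool) (w : Fin m) → count P ≡ (if P w then 1 else 0) + count (P ∖ w)
count-split {m} P w =
  trans (length-filterᵇ-split P w (allFin m)) (cong (_+ count (P ∖ w)) (count-singleton P w))

count-remove : (P : Fin m → Bool) {w : Fin m} → T (P w) → count P ≡ suc (count (P ∖ w))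
count-remove P {w} Pw =
  trans (count-split P w) (cong (λ x → (if x then 1 else 0) + count (P ∖ w)) (T⇒≡true Pw))

count-< : {P : Fin m → Bool} {Q : Fin k → Bool} {w : Fin k} (f : Fin m → Fin k) (g : Fin k → Fin m) →
          (∀ v → T (P v) → T ((Q ∖ w) (f v))) → (∀ v → T (P v) → g (f v) ≡ v) → T (Q w) →
          count P < count Q
count-< {P = P} {Q} f g P⇒Q∖w g∘f Qw =
  subst (count P <_) (sym (count-remove Q Qw)) (s≤s (count-≤ f g P⇒Q∖w g∘f))

count-≡-exchange : {P Q : Fin m → Bool} {x : Fin m} → count P ≡ count Q → T (P x) → ¬ T (Q x) →
                   ∃ λ y → T (Q y) × ¬ T (P y)
count-≡-exchange {P = P} {Q} {x} P≡Q Px ¬Qx with any? (λ y → T? (Q y ∧ not (P y)))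
... | yes (y , t) = y , T-∧ˡ t , T-not⁻ (T-∧ʳ {Q y} t)
... | no none     = ⊥-elim (<-irrefl (sym P≡Q) (count-< (λ v → v) (λ v → v) Q⇒P∖x (λ _ _ → refl) Px))
  where
  Q⇒P∖x : ∀ v → T (Q v) → T ((P ∖ x) v)
  Q⇒P∖x v Qv with T? (P v)
  ... | yes Pv  = ∖⁺ (λ { refl → ¬Qx Qv }) Pv
  ... | no ¬Pv = ⊥-elim (none (v , T-∧⁺ Qv (T-not⁺ ¬Pv)))

data Transposition (i j : Fin m) : Fin m → Fin m → Set where
  at-i : Transposition i j i j
  at-j : j ≢ i → Transposition i j j i
  away : ∀ {u} → u ≢ i → u ≢ j → Transposition i j u u

transposition : (i j u : Fin m) → Transposition i j u (transpose i j u)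
transposition i j u with u ≟ i
... | yes refl = at-i
... | no u≢i with u ≟ j
...   | yes refl = at-j u≢i
...   | no u≢j   = away u≢i u≢j

transpose-preserves : {A : Set} (f : Fin m → A) {i j : Fin m} → f i ≡ f j → ∀ u → f (transpose i j u) ≡ f u
transpose-preserves f {i} {j} fi≡fj u with transpose i j u | transposition i j u
... | _ | at-i     = sym fi≡fj
... | _ | at-j _   = fi≡fj
... | _ | away _ _ = refl

module _ {G₁ G₂ : Graph} {S₁ : VSet G₁} {S₂ : VSet G₂} (ψ : SubIso G₁ S₁ G₂ S₂) where

  from-preserves : {P₁ : VSet G₁} {P₂ : VSet G₂} → (∀ v → T (S₁ v) → P₂ (to ψ v) ≡ P₁ v) →
                   ∀ w → T (S₂ w) → P₁ (from ψ w) ≡ P₂ w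
  from-preserves {P₂ = P₂} pres w w∈ =
    trans (sym (pres (from ψ w) (from-mem ψ w w∈))) (cong P₂ (to-from ψ w w∈))

  restrict : {S₁′ : VSet G₁} {S₂′ : VSet G₂} →
             (∀ v → T (S₁′ v) → T (S₁ v)) → (∀ w → T (S₂′ w) → T (S₂ w)) →
             (∀ v → T (S₁ v) → S₂′ (to ψ v) ≡ S₁′ v) → SubIso G₁ S₁′ G₂ S₂′
  restrict S₁′⊆S₁ S₂′⊆S₂ pres = record
    { to       = to ψ
    ; from     = from ψ
    ; to-mem   = λ v t → subst T (sym (pres v (S₁′⊆S₁ v t))) t
    ; from-mem = λ w t → subst T (sym (from-preserves pres w (S₂′⊆S₂ w t))) t
    ; from-to  = λ v t → from-to ψ v (S₁′⊆S₁ v t)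
    ; to-from  = λ w t → to-from ψ w (S₂′⊆S₂ w t)
    ; adj-pres = λ u v tu tv → adj-pres ψ u v (S₁′⊆S₁ u tu) (S₁′⊆S₁ v tv)
    }

  count-SubIso : {P₁ : VSet G₁} {P₂ : VSet G₂} →
                 (∀ v → T (P₁ v) → T (S₁ v)) → (∀ w → T (P₂ w) → T (S₂ w)) →
                 (∀ v → T (S₁ v) → P₂ (to ψ v) ≡ P₁ v) → count P₁ ≡ count P₂
  count-SubIso P₁⊆S₁ P₂⊆S₂ pres = count-≡ (to ψ) (from ψ)
    (λ v t → subst T (sym (pres v (P₁⊆S₁ v t))) t)
    (λ v t → from-to ψ v (P₁⊆S₁ v t))
    (λ w t → subst T (sym (from-preserves pres w (P₂⊆S₂ w t))) t)
    (λ w t → to-from ψ w (P₂⊆S₂ w t))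

_∘ᵢ_ : {G₁ G₂ G₃ : Graph} {S₁ : VSet G₁} {S₂ : VSet G₂} {S₃ : VSet G₃} →
       SubIso G₂ S₂ G₃ S₃ → SubIso G₁ S₁ G₂ S₂ → SubIso G₁ S₁ G₃ S₃
ψ ∘ᵢ χ = record
  { to       = λ v → to ψ (to χ v)
  ; from     = λ w → from χ (from ψ w)
  ; to-mem   = λ v t → to-mem ψ (to χ v) (to-mem χ v t)
  ; from-mem = λ w t → from-mem χ (from ψ w) (from-mem ψ w t)
  ; from-to  = λ v t → trans (cong (from χ) (from-to ψ (to χ v) (to-mem χ v t))) (from-to χ v t)
  ; to-from  = λ w t → trans (cong (to ψ) (to-from χ (from ψ w) (from-mem ψ w t))) (to-from ψ w t)
  ; adj-pres = λ u v tu tv → trans (adj-pres ψ (to χ u) (to χ v) (to-mem χ u tu) (to-mem χ v tv))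
                                   (adj-pres χ u v tu tv)
  }

transpose-twins : {G : Graph} {S : VSet G} {x y : Fin (n G)} → T (S x) → T (S y) →
                  (∀ u → T (S u) → u ≢ x → u ≢ y → adj G x u ≡ adj G y u) → SubIso G S G S
transpose-twins {G} {S} {x} {y} x∈S y∈S twins = record
  { to       = transpose x y
  ; from     = transpose y x
  ; to-mem   = λ v v∈ → subst T (sym (transpose-preserves S S[x]≡S[y] v)) v∈
  ; from-mem = λ v v∈ → subst T (sym (transpose-preserves S (sym S[x]≡S[y]) v)) v∈
  ; from-to  = λ _ _ → transpose-inverse y x
  ; to-from  = λ _ _ → transpose-inverse x y
  ; adj-pres = adj-transpose
  }
  where
  S[x]≡S[y] : S x ≡ S y
  S[x]≡S[y] = trans (T⇒≡true x∈S) (sym (T⇒≡true y∈S))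
  adj-transpose : ∀ u v → T (S u) → T (S v) → adj G (transpose x y u) (transpose x y v) ≡ adj G u v
  adj-transpose u v u∈ v∈ with transpose x y u | transposition x y u | transpose x y v | transposition x y v
  ... | _ | at-i           | _ | at-i           = trans (irrefl G y) (sym (irrefl G x))
  ... | _ | at-i           | _ | at-j _         = adj-sym G y x
  ... | _ | at-i           | _ | away v≢x v≢y = sym (twins v v∈ v≢x v≢y)
  ... | _ | at-j _         | _ | at-i           = adj-sym G x y
  ... | _ | at-j _         | _ | at-j _         = trans (irrefl G x) (sym (irrefl G y))
  ... | _ | at-j _         | _ | away v≢x v≢y = twins v v∈ v≢x v≢y
  ... | _ | away u≢x u≢y | _ | at-i           =
        trans (adj-sym G u y) (trans (sym (twins u u∈ u≢x u≢y)) (adj-sym G x u))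
  ... | _ | away u≢x u≢y | _ | at-j _         =
        trans (adj-sym G u x) (trans (twins u u∈ u≢x u≢y) (adj-sym G y u))
  ... | _ | away _ _       | _ | away _ _       = refl

adj⇒≢ : (G : Graph) → ∀ {u v} → T (adj G u v) → u ≢ v
adj⇒≢ G {u} u~v refl = subst T (irrefl G u) u~v

adj-symᵀ : (G : Graph) → ∀ {u v} → T (adj G u v) → T (adj G v u)
adj-symᵀ G {u} {v} = subst T (adj-sym G u v)

allV : (G : Graph) → VSet G
allV G _ = true

Simplicial : (G : Graph) → Fin (n G) → Set
Simplicial G ω = ∀ {u w} → T (adj G u ω) → T (adj G ω w) → u ≢ w → T (adj G u w)

module _ {G : Graph} where

  walk-mono : {S S′ : VSet G} → (∀ v → T (S v) → T (S′ v)) → ∀ {u v} → Walk G S u v → Walk G S′ u v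
  walk-mono S⊆S′ (here s)     = here (S⊆S′ _ s)
  walk-mono S⊆S′ (step s a w) = step (S⊆S′ _ s) a (walk-mono S⊆S′ w)

  _++ʷ_ : {S : VSet G} → ∀ {u w v} → Walk G S u w → Walk G S w v → Walk G S u v
  here _      ++ʷ w₂ = w₂
  step s a w₁ ++ʷ w₂ = step s a (w₁ ++ʷ w₂)

  connected-minus⇒connected : ∀ {b c} → Connected G (minusV G b) → T (adj G b c) → Connected G (allV G)
  connected-minus⇒connected {b} {c} conn b~c u v _ _ = to-c u ++ʷ from-c v
    where
    c∈ : T (minusV G b c)
    c∈ = fromWitnessFalse λ c≡b → adj⇒≢ G b~c (sym c≡b)
    to-c : ∀ u → Walk G (allV G) u c
    to-c u with u ≟ b
    ... | yes refl = step tt b~c (here tt)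
    ... | no u≢b   = walk-mono _ (conn u c (fromWitnessFalse u≢b) c∈)
    from-c : ∀ v → Walk G (allV G) c v
    from-c v with v ≟ b
    ... | yes refl = step tt (adj-symᵀ G b~c) (here tt)
    ... | no v≢b   = walk-mono _ (conn c v c∈ (fromWitnessFalse v≢b))

  module _ {ω : Fin (n G)} (simplicial : Simplicial G ω) where

    avoid : ∀ {u v} → Walk G (allV G) u v → u ≢ ω → v ≢ ω → Walk G (minusV G ω) u v
    avoid-via : ∀ {u v} → T (adj G u ω) → Walk G (allV G) ω v → u ≢ ω → v ≢ ω → Walk G (minusV G ω) u v
    avoid (here _) u≢ω _ = here (fromWitnessFalse u≢ω)
    avoid (step {w = w} _ u~w W) u≢ω v≢ω with w ≟ ω
    ... | yes refl = avoid-via u~w W u≢ω v≢ω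
    ... | no w≢ω   = step (fromWitnessFalse u≢ω) u~w (avoid W w≢ω v≢ω)
    avoid-via _ (here _) _ v≢ω = ⊥-elim (v≢ω refl)
    avoid-via {u} u~ω (step {w = w} _ ω~w W) u≢ω v≢ω with u ≟ w
    ... | yes refl = avoid W u≢ω v≢ω
    ... | no u≢w   = step (fromWitnessFalse u≢ω) (simplicial u~ω ω~w u≢w)
                          (avoid W (λ w≡ω → adj⇒≢ G ω~w (sym w≡ω)) v≢ω)

    simplicial-deletion-connected : Connected G (allV G) → Connected G (minusV G ω)
    simplicial-deletion-connected conn u v u∈ v∈ =
      avoid (conn u v tt tt) (toWitnessFalse u∈) (toWitnessFalse v∈)

module _ {G : Graph} (R : IntervalRep G) where

  overlap⇒adj : ∀ {u v} → u ≢ v → ℓ R u ≤ℚ r R v → ℓ R v ≤ℚ r R u → T (adj G u v)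
  overlap⇒adj {u} {v} u≢v ℓu≤rv ℓv≤ru = Equivalence.from (adj⇔ R u v u≢v) (ℓu≤rv , ℓv≤ru)

  adj⇒overlap : ∀ {u v} → T (adj G u v) → ℓ R u ≤ℚ r R v × ℓ R v ≤ℚ r R u
  adj⇒overlap {u} {v} u~v = Equivalence.to (adj⇔ R u v (adj⇒≢ G u~v)) u~v

  rightmost : Fin (n G) → Fin (n G)
  rightmost v₀ = argmax (ℓ R) v₀ (allFin _)

  rightmost-max : ∀ v₀ v → ℓ R v ≤ℚ ℓ R (rightmost v₀)
  rightmost-max v₀ v = lookup (f[xs]≤f[argmax] v₀ (allFin _)) (∈-allFin v)

  rightmost-simplicial : ∀ v₀ → Simplicial G (rightmost v₀)
  rightmost-simplicial v₀ u~ω ω~w u≢w = overlap⇒adj u≢w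
    (ℚ.≤-trans (rightmost-max v₀ _) (proj₁ (adj⇒overlap ω~w)))
    (ℚ.≤-trans (rightmost-max v₀ _) (proj₂ (adj⇒overlap u~ω)))

isC⇒≡sC : ∀ {s} → T (isC s) → s ≡ sC
isC⇒≡sC {sC} _ = refl

≡sC⇒isC : ∀ {s} → s ≡ sC → T (isC s)
≡sC⇒isC refl = tt

isB∨isC-cases : ∀ {s} → T (isB s ∨ isC s) → s ≡ sB ⊎ s ≡ sC
isB∨isC-cases {sB} _ = inj₁ refl
isB∨isC-cases {sC} _ = inj₂ refl

isA-isC-injective : ∀ {s t} → isA s ≡ isA t → isC s ≡ isC t → s ≡ t
isA-isC-injective {sA} {sA} _  _  = refl
isA-isC-injective {sB} {sB} _  _  = refl
isA-isC-injective {sC} {sC} _  _  = refl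
isA-isC-injective {sA} {sB} () _
isA-isC-injective {sA} {sC} () _
isA-isC-injective {sB} {sA} () _
isA-isC-injective {sB} {sC} _  ()
isA-isC-injective {sC} {sA} () _
isA-isC-injective {sC} {sB} _  ()

module CleanSeparation {G : Graph} {p : Fin (n G) → Side} (cs : CleanCliqueSep G p) where

  R : IntervalRep G
  R = proj₁ (proj₂ cs)

  x₀ : ℚ
  x₀ = proj₁ (proj₁ (proj₂ (proj₂ cs)))

  x₀∈⋂C : InAllC G p R x₀
  x₀∈⋂C = proj₂ (proj₁ (proj₂ (proj₂ cs)))

  ⋂C-separates : ∀ {x} → InAllC G p R x → (∀ a → p a ≡ sA → r R a <ℚ x) × (∀ b → p b ≡ sB → x <ℚ ℓ R b)
  ⋂C-separates {x} = proj₂ (proj₂ (proj₂ cs)) x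

  side-≢ : ∀ {u v s t} → p u ≡ s → p v ≡ t → s ≢ t → u ≢ v
  side-≢ refl refl s≢t refl = s≢t refl

  A≁B : ∀ {a b} → p a ≡ sA → p b ≡ sB → ¬ T (adj G a b)
  A≁B {a} {b} pa pb = subst T (proj₁ cs a b pa pb)

  x₀∈C : ∀ {c} → p c ≡ sC → ℓ R c ≤ℚ x₀ × x₀ ≤ℚ r R c
  x₀∈C pc = x₀∈⋂C _ pc

  A<x₀ : ∀ {a} → p a ≡ sA → r R a <ℚ x₀
  A<x₀ pa = proj₁ (⋂C-separates x₀∈⋂C) _ pa

  x₀<B : ∀ {b} → p b ≡ sB → x₀ <ℚ ℓ R b
  x₀<B pb = proj₂ (⋂C-separates x₀∈⋂C) _ pb

  C-clique : ∀ {c c′} → p c ≡ sC → p c′ ≡ sC → c ≢ c′ → T (adj G c c′)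
  C-clique pc pc′ c≢c′ = overlap⇒adj R c≢c′
    (ℚ.≤-trans (proj₁ (x₀∈C pc)) (proj₂ (x₀∈C pc′))) (ℚ.≤-trans (proj₁ (x₀∈C pc′)) (proj₂ (x₀∈C pc)))

  B-C-adj : ∀ {b c} → p b ≡ sB → p c ≡ sC → ℓ R b ≤ℚ r R c → T (adj G b c)
  B-C-adj pb pc ℓb≤rc = overlap⇒adj R (side-≢ pb pc λ ()) ℓb≤rc
    (ℚ.<⇒≤ (ℚ.≤-<-trans (proj₁ (x₀∈C pc)) (ℚ.<-≤-trans (x₀<B pb) (ℓ≤r R _))))

  B-C-nonadj : ∀ {b c} → p b ≡ sB → p c ≡ sC → ¬ T (adj G b c) → r R c <ℚ ℓ R b
  B-C-nonadj pb pc b≁c = ℚ.≰⇒> λ ℓb≤rc → b≁c (B-C-adj pb pc ℓb≤rc)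

  C-A-adj : ∀ {c a} → p c ≡ sC → p a ≡ sA → ℓ R c ≤ℚ r R a → T (adj G c a)
  C-A-adj pc pa ℓc≤ra = overlap⇒adj R (side-≢ pc pa λ ()) ℓc≤ra
    (ℚ.<⇒≤ (ℚ.≤-<-trans (ℓ≤r R _) (ℚ.<-≤-trans (A<x₀ pa) (proj₂ (x₀∈C pc)))))

  C-A-nonadj : ∀ {c a} → p c ≡ sC → p a ≡ sA → ¬ T (adj G c a) → r R a <ℚ ℓ R c
  C-A-nonadj pc pa c≁a = ℚ.≰⇒> λ ℓc≤ra → c≁a (C-A-adj pc pa ℓc≤ra)

  rightmost-in-B : ∀ {b} v₀ → p b ≡ sB → p (rightmost R v₀) ≡ sB
  rightmost-in-B {b} v₀ pb with p (rightmost R v₀) in pω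
  ... | sA = ⊥-elim (ℚ.<-irrefl refl (ℚ.≤-<-trans (rightmost-max R v₀ b)
               (ℚ.≤-<-trans (ℓ≤r R _) (ℚ.<-trans (A<x₀ pω) (x₀<B pb)))))
  ... | sC = ⊥-elim (ℚ.<-irrefl refl (ℚ.≤-<-trans (rightmost-max R v₀ b)
               (ℚ.≤-<-trans (proj₁ (x₀∈C pω)) (x₀<B pb))))
  ... | sB = refl

  -- The C-vertex with leftmost right endpoint: that endpoint lies in ⋂C, hence before all of B.
  C-vertex-missing-B : ∀ {c} → p c ≡ sC →
                       Σ (Fin (n G)) λ c₀ → p c₀ ≡ sC × (∀ {b} → p b ≡ sB → ¬ T (adj G b c₀))
  C-vertex-missing-B {c} pc = c₀ , pc₀ , λ pb b~c₀ → ℚ.<-irrefl refl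
      (ℚ.<-≤-trans (proj₂ (⋂C-separates rc₀∈⋂C) _ pb) (proj₁ (adj⇒overlap R b~c₀)))
    where
    isC? : ∀ v → Dec (T (isC (p v)))
    isC? v = T? (isC (p v))
    c₀ : Fin (n G)
    c₀ = argmin (r R) c (filter isC? (allFin _))
    pc₀ : p c₀ ≡ sC
    pc₀ = isC⇒≡sC (argmin-all (r R) (≡sC⇒isC pc) (all-filter isC? (allFin _)))
    rc₀∈⋂C : InAllC G p R (r R c₀)
    rc₀∈⋂C c′ pc′ = ℚ.≤-trans (proj₁ (x₀∈C pc′)) (proj₂ (x₀∈C pc₀))
                  , lookup (f[argmin]≤f[xs] c _) (∈-filter⁺ isC? (∈-allFin c′) (≡sC⇒isC pc′))

module DistantVertex {G : Graph} {p : Fin (n G) → Side} (cs : CleanCliqueSep G p)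
                     {b : Fin (n G)} (dc : DistantChoice G p b) where

  open CleanSeparation cs

  b∈B : p b ≡ sB
  b∈B = proj₁ dc

  -- Otherwise the rightmost vertex ω lies in B, is removable, and sees fewer C-vertices than b.
  C-neighbour-sees-B : ∀ {c} → p c ≡ sC → T (adj G b c) → ∀ {b′} → p b′ ≡ sB → T (adj G b′ c)
  C-neighbour-sees-B {c} pc b~c {b′} pb′ = decidable-stable (T? (adj G b′ c)) λ b′≁c →
    <-irrefl refl (<-≤-trans (fewer b′≁c) (proj₂ (proj₂ dc) ω (rightmost-in-B b pb′) ω-removable))
    where
    ω : Fin (n G)
    ω = rightmost R b
    ω-removable : Connected G (minusV G ω)
    ω-removable = simplicial-deletion-connected (rightmost-simplicial R b)
                    (connected-minus⇒connected (proj₁ (proj₂ dc)) b~c)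
    NC : Fin (n G) → VSet G
    NC v u = adj G v u ∧ isC (p u)
    fewer : ¬ T (adj G b′ c) → count (NC ω) < count (NC b)
    fewer b′≁c = count-< (λ v → v) (λ v → v) NCω⊆NCb∖c (λ _ _ → refl) (T-∧⁺ b~c (≡sC⇒isC pc))
      where
      rc<rv : ∀ {v} → T (adj G ω v) → r R c <ℚ r R v
      rc<rv ω~v = ℚ.<-≤-trans (B-C-nonadj pb′ pc b′≁c)
                    (ℚ.≤-trans (rightmost-max R b b′) (proj₁ (adj⇒overlap R ω~v)))
      NCω⊆NCb∖c : ∀ v → T (NC ω v) → T ((NC b ∖ c) v)
      NCω⊆NCb∖c v t = ∖⁺ (λ { refl → ℚ.<-irrefl refl (rc<rv ω~v) })
        (T-∧⁺ (B-C-adj b∈B (isC⇒≡sC v∈C) (ℚ.<⇒≤ (ℚ.≤-<-trans (proj₁ (adj⇒overlap R b~c)) (rc<rv ω~v)))) v∈C)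
        where
        ω~v : T (adj G ω v)
        ω~v = T-∧ˡ t
        v∈C : T (isC (p v))
        v∈C = T-∧ʳ {adj G ω v} t

  deg⁻ : Fin (n G) → ℕ
  deg⁻ v = count (adj G v ∖ b)

  deg-split : ∀ v → deg G v ≡ (if adj G v b then 1 else 0) + deg⁻ v
  deg-split v = count-split (adj G v) b

  deg-adj : ∀ {v} → T (adj G v b) → deg G v ≡ suc (deg⁻ v)
  deg-adj v~b = count-remove (adj G _) v~b

  SeesB∖b : Fin (n G) → Set
  SeesB∖b c = ∀ {b′} → p b′ ≡ sB → b′ ≢ b → T (adj G b′ c)

  -- The transposition (x y) embeds N(y) − b into N(x) − b − a.
  A-neighbour-raises-deg⁻ : ∀ {x y a} → p x ≡ sC → p y ≡ sC → SeesB∖b x → p a ≡ sA →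
                            T (adj G x a) → ¬ T (adj G y a) → deg⁻ y < deg⁻ x
  A-neighbour-raises-deg⁻ {x} {y} {a} px py x-sees pa x~a y≁a =
    count-< (transpose x y) (transpose y x) N⁻y↪N⁻x∖a (λ _ _ → transpose-inverse y x)
            (∖⁺ (side-≢ pa b∈B λ ()) x~a)
    where
    y~⇒x~ : ∀ {u} → u ≢ b → u ≢ x → T (adj G y u) → T (adj G x u)
    y~⇒x~ {u} u≢b u≢x y~u with p u in pu
    ... | sA = C-A-adj px pu (ℚ.≤-trans (proj₁ (adj⇒overlap R x~a))
                 (ℚ.<⇒≤ (ℚ.<-≤-trans (C-A-nonadj py pa y≁a) (proj₁ (adj⇒overlap R y~u)))))
    ... | sC = C-clique px pu λ x≡u → u≢x (sym x≡u)
    ... | sB = adj-symᵀ G (x-sees pu u≢b)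
    N⁻y↪N⁻x∖a : ∀ u → T ((adj G y ∖ b) u) → T (((adj G x ∖ b) ∖ a) (transpose x y u))
    N⁻y↪N⁻x∖a u t with transpose x y u | transposition x y u
    ... | _ | at-i       = ∖⁺ (side-≢ py pa λ ())
                               (∖⁺ (side-≢ py b∈B λ ()) (C-clique px py λ { refl → y≁a x~a }))
    ... | _ | at-j _     = ⊥-elim (adj⇒≢ G (∖⁻ʳ t) refl)
    ... | _ | away u≢x _ = ∖⁺ (λ { refl → y≁a (∖⁻ʳ t) }) (∖⁺ (∖⁻ˡ t) (y~⇒x~ (∖⁻ˡ t) u≢x (∖⁻ʳ t)))

  equal-deg⁻-twins : ∀ {x y} → p x ≡ sC → p y ≡ sC → SeesB∖b x → SeesB∖b y → deg⁻ x ≡ deg⁻ y →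
                     ∀ u → T (minusV G b u) → u ≢ x → u ≢ y → adj G x u ≡ adj G y u
  equal-deg⁻-twins {x} {y} px py x-sees y-sees x≈y u u∈ u≢x u≢y with p u in pu
  ... | sA = T-ext (λ x~u → decidable-stable (T? (adj G y u)) λ y≁u →
                      <-irrefl (sym x≈y) (A-neighbour-raises-deg⁻ px py x-sees pu x~u y≁u))
                   (λ y~u → decidable-stable (T? (adj G x u)) λ x≁u →
                      <-irrefl x≈y (A-neighbour-raises-deg⁻ py px y-sees pu y~u x≁u))
  ... | sC = T-ext (λ _ → C-clique py pu λ { refl → u≢y refl }) (λ _ → C-clique px pu λ { refl → u≢x refl })
  ... | sB = T-ext (λ _ → adj-symᵀ G (y-sees pu (toWitnessFalse u∈)))
                   (λ _ → adj-symᵀ G (x-sees pu (toWitnessFalse u∈)))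

  B∪C : VSet G
  B∪C v = isB (p v) ∨ isC (p v)

  B⊆B∪C : ∀ {v} → p v ≡ sB → T (B∪C v)
  B⊆B∪C pv = subst (λ s → T (isB s ∨ isC s)) (sym pv) tt

  C⊆B∪C : ∀ {v} → p v ≡ sC → T (B∪C v)
  C⊆B∪C pv = subst (λ s → T (isB s ∨ isC s)) (sym pv) tt

  count-B∪C-≤-C-neighbour : ∀ {c} → p c ≡ sC → T (adj G b c) → count B∪C ≤ suc (suc (deg⁻ c))
  count-B∪C-≤-C-neighbour {c} pc b~c = begin
    count B∪C              ≡⟨ count-remove B∪C (C⊆B∪C pc) ⟩
    suc (count (B∪C ∖ c))  ≤⟨ s≤s (count-mono B∪C∖c⊆N) ⟩
    suc (deg G c)          ≡⟨ cong suc (deg-adj (adj-symᵀ G b~c)) ⟩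
    suc (suc (deg⁻ c))     ∎
    where
    open ≤-Reasoning
    B∪C∖c⊆N : ∀ u → T ((B∪C ∖ c) u) → T (adj G c u)
    B∪C∖c⊆N u t with isB∨isC-cases (∖⁻ʳ t)
    ... | inj₁ pu = adj-symᵀ G (C-neighbour-sees-B pc b~c pu)
    ... | inj₂ pu = C-clique pc pu λ { refl → ∖⁻ˡ t refl }

  B-deg-<-count-B∪C : ∀ {c u} → p c ≡ sC → p u ≡ sB → suc (suc (deg G u)) ≤ count B∪C
  B-deg-<-count-B∪C {c} {u} pc pu with C-vertex-missing-B pc
  ... | c₀ , pc₀ , c₀-missing-B = begin
    suc (suc (deg G u))                 ≤⟨ s≤s (s≤s (count-mono N⊆B∪C∖u∖c₀)) ⟩
    suc (suc (count ((B∪C ∖ u) ∖ c₀)))  ≡⟨ cong suc (count-remove (B∪C ∖ u) c₀∈B∪C∖u) ⟨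
    suc (count (B∪C ∖ u))               ≡⟨ count-remove B∪C (B⊆B∪C pu) ⟨
    count B∪C                           ∎
    where
    open ≤-Reasoning
    c₀∈B∪C∖u : T ((B∪C ∖ u) c₀)
    c₀∈B∪C∖u = ∖⁺ (side-≢ pc₀ pu λ ()) (C⊆B∪C pc₀)
    N⊆B∪C∖u∖c₀ : ∀ v → T (adj G u v) → T (((B∪C ∖ u) ∖ c₀) v)
    N⊆B∪C∖u∖c₀ v u~v = ∖⁺ (λ { refl → c₀-missing-B pu u~v }) (∖⁺ (λ { refl → adj⇒≢ G u~v refl }) v∈B∪C)
      where
      v∈B∪C : T (B∪C v)
      v∈B∪C with p v in pv
      ... | sA = ⊥-elim (A≁B pv pu (adj-symᵀ G u~v))
      ... | sB = tt
      ... | sC = tt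

  NbDeg : ℕ → VSet G
  NbDeg d u = adj G b u ∧ (deg G u ≡ᵇ d)

  CWithDeg⁻ : VSet G → ℕ → VSet G
  CWithDeg⁻ X e u = isC (p u) ∧ (X u ∧ (deg⁻ u ≡ᵇ e))

  CWithDeg⁻⁺ : ∀ X {e u} → p u ≡ sC → T (X u) → deg⁻ u ≡ e → T (CWithDeg⁻ X e u)
  CWithDeg⁻⁺ X {u = u} pu Xu deg⁻u≡e = T-∧⁺ (≡sC⇒isC pu) (T-∧⁺ Xu (≡⇒≡ᵇ (deg⁻ u) _ deg⁻u≡e))

  CWithDeg⁻⁻ : ∀ X {e u} → T (CWithDeg⁻ X e u) → p u ≡ sC × T (X u) × deg⁻ u ≡ e
  CWithDeg⁻⁻ X {e} {u} t = isC⇒≡sC (T-∧ˡ t) , T-∧ˡ t′ , ≡ᵇ⇒≡ (deg⁻ u) e (T-∧ʳ {X u} t′)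
    where
    t′ : T (X u ∧ (deg⁻ u ≡ᵇ e))
    t′ = T-∧ʳ {isC (p u)} t

  CWithDeg⁻-exchange : ∀ X Y {e x} → count (CWithDeg⁻ X e) ≡ count (CWithDeg⁻ Y e) →
                       p x ≡ sC → T (X x) → ¬ T (Y x) → deg⁻ x ≡ e →
                       Σ (Fin (n G)) λ y → p y ≡ sC × T (Y y) × ¬ T (X y) × deg⁻ y ≡ e
  CWithDeg⁻-exchange X Y X≈Y px Xx ¬Yx deg⁻x≡e =
    let (y , t , ¬t) = count-≡-exchange X≈Y (CWithDeg⁻⁺ X px Xx deg⁻x≡e)
                                         (λ t → ¬Yx (proj₁ (proj₂ (CWithDeg⁻⁻ Y t))))
        (py , Yy , deg⁻y≡e) = CWithDeg⁻⁻ Y t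
    in y , py , Yy , (λ Xy → ¬t (CWithDeg⁻⁺ X py Xy deg⁻y≡e)) , deg⁻y≡e

  heavy-neighbours-in-C : ∀ {c e} → p c ≡ sC → count B∪C ≤ suc (suc e) →
                          count (NbDeg (suc e)) ≡ count (CWithDeg⁻ (adj G b) e)
  heavy-neighbours-in-C {c} {e} pc B∪C≤ = count-cong ⇒ ⇐
    where
    ⇒ : ∀ u → T (NbDeg (suc e) u) → T (CWithDeg⁻ (adj G b) e u)
    ⇒ u t with T-∧ˡ t | ≡ᵇ⇒≡ (deg G u) (suc e) (T-∧ʳ {adj G b u} t) | p u in pu
    ... | b~u | _    | sA = ⊥-elim (A≁B pu b∈B (adj-symᵀ G b~u))
    ... | _   | deg≡ | sB = ⊥-elim (<-irrefl refl
          (≤-trans (subst (λ d → suc (suc d) ≤ count B∪C) deg≡ (B-deg-<-count-B∪C pc pu)) B∪C≤))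
    ... | b~u | deg≡ | sC =
          T-∧⁺ b~u (≡⇒≡ᵇ (deg⁻ u) e (suc-injective (trans (sym (deg-adj (adj-symᵀ G b~u))) deg≡)))
    ⇐ : ∀ u → T (CWithDeg⁻ (adj G b) e u) → T (NbDeg (suc e) u)
    ⇐ u t = let (_ , b~u , deg⁻u≡e) = CWithDeg⁻⁻ (adj G b) t in
      T-∧⁺ b~u (≡⇒≡ᵇ (deg G u) (suc e) (trans (deg-adj (adj-symᵀ G b~u)) (cong suc deg⁻u≡e)))

HA-label-cong : ∀ {G₁ G₂ : Graph} {p₁ : Fin (n G₁) → Side} {p₂ : Fin (n G₂) → Side} {v w} →
                p₂ w ≡ p₁ v → (p₁ v ≡ sC → deg G₂ w ≡ deg G₁ v) → HA-label G₂ p₂ w ≡ HA-label G₁ p₁ v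
HA-label-cong {p₁ = p₁} {p₂} {v} {w} w≈v deg≈ with p₁ v | p₂ w | w≈v
... | sA | _ | refl = refl
... | sB | _ | refl = refl
... | sC | _ | refl = cong just (deg≈ refl)

HA⊆minusV : ∀ {G : Graph} {p : Fin (n G) → Side} {b} → p b ≡ sB →
            ∀ v → T (HA-vertices G p v) → T (minusV G b v)
HA⊆minusV pb v t = fromWitnessFalse λ { refl → subst (λ s → T (isA s ∨ isC s)) pb t }

module DistantVertexPair {G₁ G₂ : Graph} {p₁ : Fin (n G₁) → Side} {p₂ : Fin (n G₂) → Side}
  (cs₁ : CleanCliqueSep G₁ p₁) (cs₂ : CleanCliqueSep G₂ p₂) {b₁ : Fin (n G₁)} {b₂ : Fin (n G₂)}
  (dc₁ : DistantChoice G₁ p₁ b₁) (dc₂ : DistantChoice G₂ p₂ b₂)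
  (same-degrees : map (deg G₁) (nbrs G₁ b₁) ↭ map (deg G₂) (nbrs G₂ b₂)) where

  module D₁ = DistantVertex cs₁ dc₁
  module D₂ = DistantVertex cs₂ dc₂

  K₁ : VSet G₁
  K₁ = minusV G₁ b₁

  K₂ : VSet G₂
  K₂ = minusV G₂ b₂

  C⊆K₁ : ∀ {c} → p₁ c ≡ sC → T (K₁ c)
  C⊆K₁ pc = fromWitnessFalse (CleanSeparation.side-≢ cs₁ pc D₁.b∈B λ ())

  C⊆K₂ : ∀ {c} → p₂ c ≡ sC → T (K₂ c)
  C⊆K₂ pc = fromWitnessFalse (CleanSeparation.side-≢ cs₂ pc D₂.b∈B λ ())

  count-NbDeg : ∀ d → count (D₁.NbDeg d) ≡ count (D₂.NbDeg d)
  count-NbDeg d = begin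
    count (D₁.NbDeg d)
      ≡⟨ length-filterᵇ-map (adj G₁ b₁) (deg G₁) (_≡ᵇ d) (allFin _) ⟨
    length (filterᵇ (_≡ᵇ d) (map (deg G₁) (nbrs G₁ b₁)))
      ≡⟨ ↭-length (filter-↭ (λ k → T? (k ≡ᵇ d)) same-degrees) ⟩
    length (filterᵇ (_≡ᵇ d) (map (deg G₂) (nbrs G₂ b₂)))
      ≡⟨ length-filterᵇ-map (adj G₂ b₂) (deg G₂) (_≡ᵇ d) (allFin _) ⟩
    count (D₂.NbDeg d)
      ∎
    where open ≡-Reasoning

  Iso : Set
  Iso = SubIso G₁ K₁ G₂ K₂

  SidePreserving : Iso → Set
  SidePreserving ψ = ∀ v → T (K₁ v) → p₂ (to ψ v) ≡ p₁ v

  Aligned : Iso → Set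
  Aligned ψ = ∀ c → p₁ c ≡ sC → T (adj G₁ b₁ c) → T (adj G₂ b₂ (to ψ c))

  Lost : Iso → VSet G₁
  Lost ψ c = isC (p₁ c) ∧ (adj G₁ b₁ c ∧ not (adj G₂ b₂ (to ψ c)))

  mismatch : Iso → ℕ
  mismatch ψ = count (Lost ψ)

  Lost⁺ : ∀ ψ {c} → p₁ c ≡ sC → T (adj G₁ b₁ c) → ¬ T (adj G₂ b₂ (to ψ c)) → T (Lost ψ c)
  Lost⁺ ψ pc b₁~c b₂≁ψc = T-∧⁺ (≡sC⇒isC pc) (T-∧⁺ b₁~c (T-not⁺ b₂≁ψc))

  Lost⁻ : ∀ ψ {c} → T (Lost ψ c) → p₁ c ≡ sC × T (adj G₁ b₁ c) × ¬ T (adj G₂ b₂ (to ψ c))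
  Lost⁻ ψ {c} t = isC⇒≡sC (T-∧ˡ t) , T-∧ˡ t′ , T-not⁻ (T-∧ʳ {adj G₁ b₁ c} t′)
    where
    t′ : T (adj G₁ b₁ c ∧ not (adj G₂ b₂ (to ψ c)))
    t′ = T-∧ʳ {isC (p₁ c)} t

  module _ (ψ : Iso) (ψ-sides : SidePreserving ψ) where

    count-∖b-preserved : ∀ {P₁ : VSet G₁} {P₂ : VSet G₂} → (∀ v → T (K₁ v) → P₂ (to ψ v) ≡ P₁ v) →
                         count (P₁ ∖ b₁) ≡ count (P₂ ∖ b₂)
    count-∖b-preserved {P₁} {P₂} pres =
      count-SubIso ψ (λ _ t → fromWitnessFalse (∖⁻ˡ t)) (λ _ t → fromWitnessFalse (∖⁻ˡ t)) pres∖b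
      where
      pres∖b : ∀ v → T (K₁ v) → (P₂ ∖ b₂) (to ψ v) ≡ (P₁ ∖ b₁) v
      pres∖b v v∈ = begin
        (P₂ ∖ b₂) (to ψ v)  ≡⟨ ∖-≢ P₂ (toWitnessFalse (to-mem ψ v v∈)) ⟩
        P₂ (to ψ v)          ≡⟨ pres v v∈ ⟩
        P₁ v                 ≡⟨ ∖-≢ P₁ (toWitnessFalse v∈) ⟨
        (P₁ ∖ b₁) v          ∎
        where open ≡-Reasoning

    deg⁻-preserved : ∀ v → T (K₁ v) → D₂.deg⁻ (to ψ v) ≡ D₁.deg⁻ v
    deg⁻-preserved v v∈ = sym (count-∖b-preserved λ u u∈ → adj-pres ψ v u v∈ u∈)

    count-B∪C-preserved : count D₁.B∪C ≡ count D₂.B∪C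
    count-B∪C-preserved = begin
      count D₁.B∪C               ≡⟨ count-remove D₁.B∪C (D₁.B⊆B∪C D₁.b∈B) ⟩
      suc (count (D₁.B∪C ∖ b₁))  ≡⟨ cong suc (count-∖b-preserved λ v v∈ →
                                        cong (λ s → isB s ∨ isC s) (ψ-sides v v∈)) ⟩
      suc (count (D₂.B∪C ∖ b₂))  ≡⟨ count-remove D₂.B∪C (D₂.B⊆B∪C D₂.b∈B) ⟨
      count D₂.B∪C               ∎
      where open ≡-Reasoning

    N₂∘ψ : VSet G₁
    N₂∘ψ c = adj G₂ b₂ (to ψ c)

    count-CWithDeg⁻-preserved : ∀ e → count (D₂.CWithDeg⁻ (adj G₂ b₂) e) ≡ count (D₁.CWithDeg⁻ N₂∘ψ e)
    count-CWithDeg⁻-preserved e =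
      sym (count-SubIso ψ (λ _ t → C⊆K₁ (isC⇒≡sC (T-∧ˡ t))) (λ _ t → C⊆K₂ (isC⇒≡sC (T-∧ˡ t))) pres)
      where
      pres : ∀ v → T (K₁ v) → D₂.CWithDeg⁻ (adj G₂ b₂) e (to ψ v) ≡ D₁.CWithDeg⁻ N₂∘ψ e v
      pres v v∈ = cong₂ (λ s d → isC s ∧ (N₂∘ψ v ∧ (d ≡ᵇ e))) (ψ-sides v v∈) (deg⁻-preserved v v∈)

    balanced : ∀ {c e} → p₁ c ≡ sC → count D₁.B∪C ≤ suc (suc e) →
               count (D₁.CWithDeg⁻ (adj G₁ b₁) e) ≡ count (D₁.CWithDeg⁻ N₂∘ψ e)
    balanced {c} {e} pc B∪C≤ = begin
      count (D₁.CWithDeg⁻ (adj G₁ b₁) e)  ≡⟨ D₁.heavy-neighbours-in-C pc B∪C≤ ⟨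
      count (D₁.NbDeg (suc e))            ≡⟨ count-NbDeg (suc e) ⟩
      count (D₂.NbDeg (suc e))            ≡⟨ D₂.heavy-neighbours-in-C (trans (ψ-sides c (C⊆K₁ pc)) pc)
                                                (subst (_≤ suc (suc e)) count-B∪C-preserved B∪C≤) ⟩
      count (D₂.CWithDeg⁻ (adj G₂ b₂) e)  ≡⟨ count-CWithDeg⁻-preserved e ⟩
      count (D₁.CWithDeg⁻ N₂∘ψ e)         ∎
      where open ≡-Reasoning

    module Swap {x y} (px : p₁ x ≡ sC) (py : p₁ y ≡ sC) (b₁~x : T (adj G₁ b₁ x)) (b₁≁y : ¬ T (adj G₁ b₁ y))
                (b₂≁ψx : ¬ T (N₂∘ψ x)) (b₂~ψy : T (N₂∘ψ y)) (x≈y : D₁.deg⁻ x ≡ D₁.deg⁻ y) where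

      x-sees : D₁.SeesB∖b x
      x-sees pb′ _ = D₁.C-neighbour-sees-B px b₁~x pb′

      y-sees : D₁.SeesB∖b y
      y-sees {b′} pb′ b′≢b₁ = subst T (adj-pres ψ b′ y b′∈ (C⊆K₁ py))
        (D₂.C-neighbour-sees-B (trans (ψ-sides y (C⊆K₁ py)) py) b₂~ψy (trans (ψ-sides b′ b′∈) pb′))
        where
        b′∈ : T (K₁ b′)
        b′∈ = fromWitnessFalse b′≢b₁

      τ : SubIso G₁ K₁ G₁ K₁
      τ = transpose-twins (C⊆K₁ px) (C⊆K₁ py) (D₁.equal-deg⁻-twins px py x-sees y-sees x≈y)

      swapped-sides : SidePreserving (ψ ∘ᵢ τ)
      swapped-sides v v∈ = trans (ψ-sides _ (to-mem τ v v∈)) (transpose-preserves p₁ (trans px (sym py)) v)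

      fewer-lost : mismatch (ψ ∘ᵢ τ) < mismatch ψ
      fewer-lost = count-< (λ c → c) (λ c → c) Lost′⊆Lost∖x (λ _ _ → refl) (Lost⁺ ψ px b₁~x b₂≁ψx)
        where
        Lost′⊆Lost∖x : ∀ c → T (Lost (ψ ∘ᵢ τ) c) → T ((Lost ψ ∖ x) c)
        Lost′⊆Lost∖x c t with transpose x y c | transposition x y c | Lost⁻ (ψ ∘ᵢ τ) t
        ... | _ | at-i       | _ , _ , b₂≁ψy       = ⊥-elim (b₂≁ψy b₂~ψy)
        ... | _ | at-j _     | _ , b₁~y , _        = ⊥-elim (b₁≁y b₁~y)
        ... | _ | away c≢x _ | pc , b₁~c , b₂≁ψc = ∖⁺ c≢x (Lost⁺ ψ pc b₁~c b₂≁ψc)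

    improve : ∀ {x} → T (Lost ψ x) → Σ Iso λ ψ′ → SidePreserving ψ′ × mismatch ψ′ < mismatch ψ
    improve t =
      let (px , b₁~x , b₂≁ψx) = Lost⁻ ψ t
          (y , py , b₂~ψy , b₁≁y , y≈x) = D₁.CWithDeg⁻-exchange (adj G₁ b₁) N₂∘ψ
            (balanced px (D₁.count-B∪C-≤-C-neighbour px b₁~x)) px b₁~x b₂≁ψx refl
          open Swap px py b₁~x b₁≁y b₂≁ψx b₂~ψy (sym y≈x)
      in ψ ∘ᵢ τ , swapped-sides , fewer-lost

    aligned-reflects : Aligned ψ → ∀ c → p₁ c ≡ sC → T (N₂∘ψ c) → T (adj G₁ b₁ c)
    aligned-reflects aligned y py b₂~ψy = decidable-stable (T? (adj G₁ b₁ y)) λ b₁≁y →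
      let (x , px , b₁~x , b₂≁ψx , _) = D₁.CWithDeg⁻-exchange N₂∘ψ (adj G₁ b₁)
            (sym (balanced py B∪C≤)) py b₂~ψy b₁≁y refl
      in b₂≁ψx (aligned x px b₁~x)
      where
      B∪C≤ : count D₁.B∪C ≤ suc (suc (D₁.deg⁻ y))
      B∪C≤ = subst₂ _≤_ (sym count-B∪C-preserved) (cong (λ d → suc (suc d)) (deg⁻-preserved y (C⊆K₁ py)))
               (D₂.count-B∪C-≤-C-neighbour (trans (ψ-sides y (C⊆K₁ py)) py) b₂~ψy)

    HA-annotated-iso : Aligned ψ →
                       AnnIso G₁ (HA-vertices G₁ p₁) (HA-label G₁ p₁) G₂ (HA-vertices G₂ p₂) (HA-label G₂ p₂)
    HA-annotated-iso aligned =
      restrict ψ HA₁⊆K₁ (HA⊆minusV {G = G₂} {p = p₂} D₂.b∈B)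
        (λ v v∈ → cong (λ s → isA s ∨ isC s) (ψ-sides v v∈)) ,
      λ v v∈ → HA-label-cong {p₁ = p₁} {p₂ = p₂} (ψ-sides v (HA₁⊆K₁ v v∈)) (C-deg-preserved v)
      where
      HA₁⊆K₁ : ∀ v → T (HA-vertices G₁ p₁ v) → T (K₁ v)
      HA₁⊆K₁ = HA⊆minusV {G = G₁} {p = p₁} D₁.b∈B
      C-deg-preserved : ∀ c → p₁ c ≡ sC → deg G₂ (to ψ c) ≡ deg G₁ c
      C-deg-preserved c pc = begin
        deg G₂ (to ψ c)
          ≡⟨ D₂.deg-split (to ψ c) ⟩
        (if adj G₂ (to ψ c) b₂ then 1 else 0) + D₂.deg⁻ (to ψ c)
          ≡⟨ cong₂ (λ a d → (if a then 1 else 0) + d) b-adjacency (deg⁻-preserved c (C⊆K₁ pc)) ⟩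
        (if adj G₁ c b₁ then 1 else 0) + D₁.deg⁻ c
          ≡⟨ D₁.deg-split c ⟨
        deg G₁ c
          ∎
        where
        open ≡-Reasoning
        b-adjacency : adj G₂ (to ψ c) b₂ ≡ adj G₁ c b₁
        b-adjacency = trans (adj-sym G₂ _ _)
          (trans (T-ext (aligned-reflects aligned c pc) (aligned c pc)) (adj-sym G₁ _ _))

  align : ∀ k ψ → SidePreserving ψ → mismatch ψ ≤ k → Σ Iso λ ψ′ → SidePreserving ψ′ × Aligned ψ′
  align k ψ ψ-sides bound with any? (λ c → T? (Lost ψ c))
  ... | no none = ψ , ψ-sides , λ c pc b₁~c →
                    decidable-stable (T? _) λ b₂≁ψc → none (c , Lost⁺ ψ pc b₁~c b₂≁ψc)
  align zero    ψ ψ-sides bound | yes (_ , t) =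
    ⊥-elim (n≮0 (<-≤-trans (proj₂ (proj₂ (improve ψ ψ-sides t))) bound))
  align (suc k) ψ ψ-sides bound | yes (_ , t) =
    let (ψ′ , ψ′-sides , fewer) = improve ψ ψ-sides t in align k ψ′ ψ′-sides (≤-pred (≤-trans fewer bound))

lemma26 : (G₁ G₂ : Graph)
    (p₁ : Fin (n G₁) → Side) (p₂ : Fin (n G₂) → Side)
    (b₁ : Fin (n G₁)) (b₂ : Fin (n G₂)) →
    IsIntervalGraph G₁ → IsIntervalGraph G₂ →
    CleanCliqueSep G₁ p₁ → CleanCliqueSep G₂ p₂ →
    2 ≤ size G₁ (λ v → isB (p₁ v)) → 2 ≤ size G₂ (λ v → isB (p₂ v)) →
    DistantChoice G₁ p₁ b₁ → DistantChoice G₂ p₂ b₂ →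
    map (deg G₁) (nbrs G₁ b₁) ↭ map (deg G₂) (nbrs G₂ b₂) →
    (φ : SubIso G₁ (minusV G₁ b₁) G₂ (minusV G₂ b₂)) →
    (∀ v → T (minusV G₁ b₁ v) →
       (isA (p₁ v) ≡ isA (p₂ (to φ v))) × (isC (p₁ v) ≡ isC (p₂ (to φ v)))) →
    AnnIso G₁ (HA-vertices G₁ p₁) (HA-label G₁ p₁)
           G₂ (HA-vertices G₂ p₂) (HA-label G₂ p₂)
lemma26 G₁ G₂ p₁ p₂ b₁ b₂ _ _ cs₁ cs₂ _ _ dc₁ dc₂ same-degrees φ φ-sides =
  let (ψ , ψ-sides , aligned) = align (mismatch φ) φ φ-preserves-sides ≤-refl
  in HA-annotated-iso ψ ψ-sides aligned
  where
  open DistantVertexPair cs₁ cs₂ dc₁ dc₂ same-degrees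
  φ-preserves-sides : SidePreserving φ
  φ-preserves-sides v v∈ = sym (isA-isC-injective (proj₁ (φ-sides v v∈)) (proj₂ (φ-sides v v∈)))
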